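{- Fix any positive integers $k\leq n$. Let $\mathcal{A}$ be a family of $k\times n$ matrices over $\mathbb{F}_2$ that is $(n,k)$-covering, and for each $A\in\mathcal{A}$ let $M_A$ be the NFA defined in the context. Then $\bigcup_{A\in\mathcal{A}}L_\oplus(M_A)=L_k(n)$.
   Context: $L_k(n)\subseteq[n]^k$ is the set of words $w_1\cdots w_k$ with $w_1,\ldots,w_k$ all distinct. A set $\mathcal{A}$ of $k\times n$ matrices over $\mathbb{F}_2$ is $(n,k)$-covering if for every $k$ distinct column indices $i_1,\ldots,i_k\in[n]$ some $A\in\mathcal{A}$ has columns $i_1,\ldots,i_k$ linearly independent. All sums are in $\mathbb{F}_2$. For a $k\times n$ matrix $A$ with columns $v_1,\ldots,v_n\in\{0,1\}^k$ and non-empty $S\subseteq[k]$, let $T_{A,S}=\{i\in[n]:\sum_{j\in S}v_{i,j}=1\}$. The NFA $M_A$ over alphabet $[n]$ has a start state $q_0$, a single accepting state $q_k$, and for each non-empty $S\subseteq[k]$ private states $q^S_1,\ldots,q^S_{k-1}$; writing $q^S_0=q_0$ and $q^S_k=q_k$, for each $0\leq j\leq k-1$ and each $i\in T_{A,S}$ there is a transition from $q^S_j$ to $q^S_{j+1}$ labeled $i$. For an NFA $M$, its XOR-language $L_\oplus(M)$ is the set of words $w$ having an odd number of paths labeled $w$ from the start state to an accepting state. -}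

module Defs where

open import Data.Nat using (ℕ; zero; suc; _+_; _%_; _≤_)
open import Data.Bool using (Bool; true; false; _∧_; _∨_; _xor_; if_then_else_; T)
open import Data.Bool.Properties using (T-irrelevant) renaming (_≟_ to _≟ᵇ_)
open import Data.Fin using (Fin; zero; suc)
open import Data.Fin.Properties using () renaming (_≟_ to _≟ᶠ_)
open import Data.Fin.Subset using (Subset)
open import Data.Vec using (Vec; []; _∷_; lookup)
open import Data.Vec.Properties using (≡-dec)
open import Data.List using (List; []; _∷_; [_]; map; _++_; concatMap; allFin; length)
open import Data.Nat.ListAction using (sum)
open import Data.List.Relation.Unary.Unique.Propositional using (Unique)
open import Data.Maybe using (Maybe; just; nothing)
open import Data.Product using (Σ; _×_; _,_; ∃-syntax)
open import Function using (Injective; _∘_)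
open import Relation.Binary using (DecidableEquality)
open import Relation.Binary.PropositionalEquality using (_≡_; refl; cong)
open import Relation.Nullary using (yes; no; ⌊_⌋)

-- F₂ = Bool (addition = xor, multiplication = ∧)

⨁ : ∀ {k} → (Fin k → Bool) → Bool
⨁ {zero}  f = false
⨁ {suc k} f = f zero xor ⨁ (f ∘ suc)

-- k × n matrices over F₂ : entry (row j, column i) is  A j i
Matrix : ℕ → ℕ → Set
Matrix k n = Fin k → Fin n → Bool

column : ∀ {k n} → Matrix k n → Fin n → (Fin k → Bool)
column A i j = A j i

LinearlyIndependent : ∀ {m k} → (Fin m → (Fin k → Bool)) → Set
LinearlyIndependent {m} {k} v =
  (c : Fin m → Bool) → (∀ (r : Fin k) → ⨁ (λ j → c j ∧ v j r) ≡ false) →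
  ∀ (j : Fin m) → c j ≡ false

Covering : ∀ (n k : ℕ) → (Matrix k n → Set) → Set
Covering n k 𝒜 =
  (ι : Fin k → Fin n) → Injective _≡_ _≡_ ι →
  ∃[ A ] (𝒜 A × LinearlyIndependent (λ j → column A (ι j)))

Lk : (k n : ℕ) → List (Fin n) → Set
Lk k n w = length w ≡ k × Unique w

-- NFAs over an alphabet Fin n, with a finite transition relation given
-- as a (duplicate-free) list of transitions (source , label , target).

record NFA (n : ℕ) : Set₁ where
  field
    State       : Set
    _≟Q_        : DecidableEquality State
    start       : State
    accepting   : State → Bool
    transitions : List (State × Fin n × State)

pathsFrom : ∀ {n} (M : NFA n) → NFA.State M → List (Fin n) → ℕ
pathsFrom M q []      = if NFA.accepting M q then 1 else 0
pathsFrom M q (a ∷ w) = sum (map step (NFA.transitions M))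
  where
  open NFA M
  step : State × Fin _ × State → ℕ
  step (p , b , r) = if ⌊ p ≟Q q ⌋ ∧ ⌊ b ≟ᶠ a ⌋ then pathsFrom M r w else 0

_∈⊕_ : ∀ {n} → List (Fin n) → NFA n → Set
w ∈⊕ M = pathsFrom M (NFA.start M) w % 2 ≡ 1

nonemptyᵇ : ∀ {k} → Subset k → Bool
nonemptyᵇ []      = false
nonemptyᵇ (b ∷ S) = b ∨ nonemptyᵇ S

NESubset : ℕ → Set
NESubset k = Σ (Subset k) (T ∘ nonemptyᵇ)

allSubsets : ∀ k → List (Subset k)
allSubsets zero    = [ [] ]
allSubsets (suc k) = map (true ∷_) (allSubsets k) ++ map (false ∷_) (allSubsets k)

nonemptySubsets : ∀ k → List (NESubset k)
nonemptySubsets zero    = []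
nonemptySubsets (suc k) =
  map (λ S → (true ∷ S , _)) (allSubsets k) ++
  map (λ { (S , p) → (false ∷ S , p) }) (nonemptySubsets k)

-- i ∈ T_{A,S}  iff  Σ_{j ∈ S} v_{i,j} = 1
inT : ∀ {k n} → Matrix k n → Subset k → Fin n → Bool
inT A S i = ⨁ (λ j → lookup S j ∧ A j i)

-- states of M_A: q₀, q_k, and q^S_{j+1} (j : Fin (k ∸ 1)) for non-empty S
data MState (k : ℕ) : Set where
  q₀   : MState k
  qacc : MState k
  qmid : NESubset k → Fin (Data.Nat._∸_ k 1) → MState k

private
  NE-≟ : ∀ {k} → DecidableEquality (NESubset k)
  NE-≟ (S , p) (S′ , p′) with ≡-dec _≟ᵇ_ S S′
  ... | no ne = no λ { refl → ne refl }
  ... | yes refl with T-irrelevant p p′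
  ... | refl = yes refl

MState-≟ : ∀ {k} → DecidableEquality (MState k)
MState-≟ q₀ q₀ = yes refl
MState-≟ q₀ qacc = no λ ()
MState-≟ q₀ (qmid _ _) = no λ ()
MState-≟ qacc q₀ = no λ ()
MState-≟ qacc qacc = yes refl
MState-≟ qacc (qmid _ _) = no λ ()
MState-≟ (qmid _ _) q₀ = no λ ()
MState-≟ (qmid _ _) qacc = no λ ()
MState-≟ (qmid S j) (qmid S′ j′) with NE-≟ S S′ | j ≟ᶠ j′
... | yes refl | yes refl = yes refl
... | no ne    | _        = no λ { refl → ne refl }
... | yes _    | no ne    = no λ { refl → ne refl }

lowerLast : ∀ {m} → Fin (suc m) → Maybe (Fin m)
lowerLast {zero}  zero    = nothing
lowerLast {suc m} zero    = just zero
lowerLast {suc m} (suc i) = Data.Maybe.map suc (lowerLast i)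

-- q^S_j for j ∈ {0,…,k-1}  (source of the j-th edge of the S-chain)
srcState : ∀ {m} → NESubset (suc m) → Fin (suc m) → MState (suc m)
srcState S zero    = q₀
srcState S (suc j) = qmid S j

-- q^S_{j+1} for j ∈ {0,…,k-1}  (target of the j-th edge of the S-chain)
tgtState : ∀ {m} → NESubset (suc m) → Fin (suc m) → MState (suc m)
tgtState S j with lowerLast j
... | nothing = qacc
... | just j′ = qmid S j′

MTransitions : ∀ {k n} → Matrix k n → List (MState k × Fin n × MState k)
MTransitions {zero}  A = []
MTransitions {suc m} {n} A =
  concatMap (λ S →
    concatMap (λ j →
      concatMap (λ i →
        if inT A (Σ.proj₁ S) i then [ (srcState S j , i , tgtState S j) ] else [])
      (allFin n))
    (allFin (suc m)))
  (nonemptySubsets (suc m))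

M : ∀ {k n} → Matrix k n → NFA n
M {k} {n} A = record
  { State       = MState k
  ; _≟Q_        = MState-≟
  ; start       = q₀
  ; accepting   = λ q → ⌊ MState-≟ q qacc ⌋
  ; transitions = MTransitions A
  }

module Submission where

-- The accepting paths of M_A labelled w correspond to the non-empty S ⊆ [k] with w ∈ T_{A,S}^k, one path each,
-- and S = ∅ can be added since T_{A,∅} is empty. Writing v_i for the i-th column of A, the condition
-- w ∈ T_{A,S}^k says that |w| = k and that S ∈ F₂^k solves the square system ⟨S, v_{w_j}⟩ = 1 (j ∈ [k]).
-- Over F₂ a square system has an odd number of solutions exactly when its rows are linearly independent:
-- a row with a leading 1 lets us eliminate the first unknown, which preserves both the parity of the number
-- of solutions and the independence of the rows; if no row has a leading 1, the solutions come in pairs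
-- differing in the first unknown, while the rows are dependent because k of them fit in F₂^(k-1).
-- So w ∈ L_⊕(M_A) iff |w| = k and v_{w_1}, …, v_{w_k} are independent. Independent columns are distinct,
-- hence so are the letters of w; conversely the covering property provides such an A for every w ∈ L_k(n).

open import Defs
open import Algebra.Bundles using (CommutativeRing)
open import Data.Bool using (Bool; true; false; not; _∧_; _xor_; if_then_else_)
open import Data.Bool.Properties
  using ( xor-∧-commutativeRing; ∧-commutativeMonoid; ∧-distribˡ-xor; ∧-distribʳ-xor; ∧-identityʳ; ∧-zeroʳ
        ; ∧-assoc; xor-same; xor-comm; xor-identityʳ; ¬-not; if-eta; if-∧ )
  renaming (_≟_ to _≟ᵇ_)
open import Data.Fin using (Fin; zero; suc; punchIn; punchOut; toℕ)
open import Data.Fin.Properties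
  using (any?; punchIn-punchOut; punchInᵢ≢i; toℕ<n; 0≢1+n; suc-injective)
  renaming (_≟_ to _≟ᶠ_)
open import Data.Fin.Subset using (Subset)
open import Data.List as List using (List; []; _∷_; [_]; map; _++_; concatMap; allFin; length; tabulate)
open import Data.List.Membership.Propositional.Properties using (∈-lookup)
open import Data.List.Properties using (map-++; map-cong; map-∘; map-tabulate)
open import Data.List.Relation.Unary.All as All using ()
open import Data.List.Relation.Unary.AllPairs using ([]; _∷_)
open import Data.List.Relation.Unary.Any.Properties using (lookup-index)
open import Data.List.Relation.Unary.Unique.Propositional using (Unique)
open import Data.Maybe using (just; nothing; maybe)
open import Data.Nat using (ℕ; zero; suc; _+_; _∸_; _%_; _≤_; _<_; z≤n; s≤s) renaming (_≟_ to _≟ℕ_)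
open import Data.Nat.DivMod using (%-distribˡ-+)
open import Data.Nat.ListAction using (sum)
open import Data.Nat.ListAction.Properties using (sum-++)
open import Data.Nat.Properties using (m≤n⇒m≤1+n; 1+n≰n; +-identityʳ; +-comm; +-assoc; n∸n≡0)
open import Data.Product using (_×_; _,_; proj₁; ∃-syntax)
open import Data.Vec using (Vec; []; _∷_; lookup; replicate)
open import Data.Vec.Functional using (insertAt)
open import Data.Vec.Functional.Properties using (insertAt-lookup; insertAt-punchIn)
open import Data.Vec.Properties using (∷-injectiveʳ; lookup-replicate)
open import Function using (_∘_; Injective)
open import Function.Bundles using (_⇔_; mk⇔; Equivalence)
open import Function.Properties.Equivalence using () renaming (trans to ⇔-trans; sym to ⇔-sym)
open import Relation.Binary.PropositionalEquality
  using (_≡_; _≢_; refl; sym; trans; cong; cong₂; module ≡-Reasoning)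
open import Relation.Nullary using (yes; no; contradiction)
open import Relation.Nullary.Decidable using (⌊_⌋)
open import Tactic.RingSolver using (solve-∀)
open import Tactic.RingSolver.Core.AlmostCommutativeRing using (AlmostCommutativeRing; fromCommutativeRing)

F₂ : CommutativeRing _ _
F₂ = xor-∧-commutativeRing

F₂-solver : AlmostCommutativeRing _ _
F₂-solver = fromCommutativeRing F₂ λ { false → just refl ; true → nothing }

open AlmostCommutativeRing F₂-solver using (1#) renaming (_+_ to _⊕_; _*_ to _⊛_)

open import Algebra.Properties.Semiring.Sum (CommutativeRing.semiring F₂)
  using (sum-syntax; sum-cong-≗; sum-remove; sum-replicate-zero; ∑-distrib-+; *-distribˡ-sum; *-distribʳ-sum)
open import Algebra.Properties.CommutativeMonoid.Sum ∧-commutativeMonoid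
  using () renaming (sum to ⋀; sum-cong-≗ to ⋀-cong; sum-remove to ⋀-remove)

⨁≡∑ : ∀ {k} (f : Fin k → Bool) → ⨁ f ≡ ∑[ j < k ] f j
⨁≡∑ {zero}  f = refl
⨁≡∑ {suc k} f = cong (f zero xor_) (⨁≡∑ (f ∘ suc))

∑-zero : ∀ {k} {f : Fin k → Bool} → (∀ j → f j ≡ false) → ∑[ j < k ] f j ≡ false
∑-zero {k} f≡0 = trans (sum-cong-≗ f≡0) (sum-replicate-zero k)

∑-∧-xor : ∀ {k} (c x y : Fin k → Bool) →
  ∑[ j < k ] (c j ∧ (x j xor y j)) ≡ ∑[ j < k ] (c j ∧ x j) xor ∑[ j < k ] (c j ∧ y j)
∑-∧-xor c x y = trans (sum-cong-≗ λ j → ∧-distribˡ-xor (c j) (x j) (y j))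
  (∑-distrib-+ (λ j → c j ∧ x j) (λ j → c j ∧ y j))

xor≡false⇒≡ : ∀ {x y} → x xor y ≡ false → x ≡ y
xor≡false⇒≡ {false} {false} _ = refl
xor≡false⇒≡ {true}  {true}  _ = refl

-- Linear independence over F₂ and Gaussian elimination

combination : ∀ {m d} → (Fin m → Bool) → (Fin m → Fin d → Bool) → Fin d → Bool
combination {m} c v r = ∑[ j < m ] (c j ∧ v j r)

Independent : ∀ {m d} → (Fin m → Fin d → Bool) → Set
Independent v = ∀ c → (∀ r → combination c v r ≡ false) → ∀ j → c j ≡ false

linearlyIndependent⇔independent : ∀ {m d} (v : Fin m → Fin d → Bool) →
  LinearlyIndependent v ⇔ Independent v
linearlyIndependent⇔independent v = mk⇔
  (λ li c cv≡0 → li c (λ r → trans (⨁≡∑ (λ j → c j ∧ v j r)) (cv≡0 r)))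
  (λ iv c cv≡0 → iv c (λ r → trans (sym (⨁≡∑ (λ j → c j ∧ v j r))) (cv≡0 r)))

combination-punchIn : ∀ {m d} c (v : Fin (suc m) → Fin d → Bool) p r →
  combination c v r ≡ (c p ∧ v p r) xor combination (c ∘ punchIn p) (v ∘ punchIn p) r
combination-punchIn c v p r = sum-remove (λ j → c j ∧ v j r)

-- One step of Gaussian elimination on the first coordinate, with pivot v p.
eliminate : ∀ {m d} → (Fin (suc m) → Fin (suc d) → Bool) → Fin (suc m) → Fin m → Fin d → Bool
eliminate v p j r = v (punchIn p j) (suc r) xor (v (punchIn p j) zero ∧ v p (suc r))

combination-eliminate : ∀ {m d} c (v : Fin (suc m) → Fin (suc d) → Bool) p r →
  combination c (eliminate v p) r ≡
  (combination c (v ∘ punchIn p) zero ∧ v p (suc r)) xor combination c (v ∘ punchIn p) (suc r)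
combination-eliminate {m} c v p r = begin
  ∑[ j < m ] (c j ∧ (u j xor (a j ∧ y)))             ≡⟨ ∑-∧-xor c u (λ j → a j ∧ y) ⟩
  ∑[ j < m ] (c j ∧ u j) xor ∑[ j < m ] (c j ∧ (a j ∧ y))
    ≡⟨ cong (∑[ j < m ] (c j ∧ u j) xor_) (sum-cong-≗ λ j → sym (∧-assoc (c j) (a j) y)) ⟩
  ∑[ j < m ] (c j ∧ u j) xor ∑[ j < m ] ((c j ∧ a j) ∧ y)
    ≡⟨ cong (∑[ j < m ] (c j ∧ u j) xor_) (sym (*-distribʳ-sum y (λ j → c j ∧ a j))) ⟩
  ∑[ j < m ] (c j ∧ u j) xor (∑[ j < m ] (c j ∧ a j) ∧ y)
    ≡⟨ xor-comm (∑[ j < m ] (c j ∧ u j)) _ ⟩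
  (∑[ j < m ] (c j ∧ a j) ∧ y) xor ∑[ j < m ] (c j ∧ u j)  ∎
  where
  open ≡-Reasoning
  u a : Fin m → Bool
  u j = v (punchIn p j) (suc r)
  a j = v (punchIn p j) zero
  y = v p (suc r)

module _ {m d} (v : Fin (suc m) → Fin (suc d) → Bool) (p : Fin (suc m)) (pivot : v p zero ≡ true) where

  eliminate-independent : Independent v → Independent (eliminate v p)
  eliminate-independent iv c′ c′w≡0 j =
    trans (sym (insertAt-punchIn c′ p α j)) (iv c cv≡0 (punchIn p j))
    where
    α = combination c′ (v ∘ punchIn p) zero
    c = insertAt c′ p α
    split : ∀ r → combination c v r ≡ (α ∧ v p r) xor combination c′ (v ∘ punchIn p) r
    split r = trans (combination-punchIn c v p r) (cong₂ _xor_
      (cong (_∧ v p r) (insertAt-lookup c′ p α))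
      (sum-cong-≗ λ j → cong (_∧ v (punchIn p j) r) (insertAt-punchIn c′ p α j)))
    cv≡0 : ∀ r → combination c v r ≡ false
    cv≡0 zero    = trans (split zero) (trans (cong (λ t → (α ∧ t) xor α) pivot)
                     (trans (cong (_xor α) (∧-identityʳ α)) (xor-same α)))
    cv≡0 (suc r) = trans (split (suc r)) (trans (sym (combination-eliminate c′ v p r)) (c′w≡0 r))

  eliminate-independent⁻ : Independent (eliminate v p) → Independent v
  eliminate-independent⁻ iw c cv≡0 = c≡0
    where
    c′ = c ∘ punchIn p
    α = combination c′ (v ∘ punchIn p) zero
    split : ∀ r → combination c v r ≡ (c p ∧ v p r) xor combination c′ (v ∘ punchIn p) r
    split = combination-punchIn c v p
    cp≡α : c p ≡ α
    cp≡α = xor≡false⇒≡ (trans (cong (_xor α) (sym (trans (cong (c p ∧_) pivot) (∧-identityʳ (c p)))))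
                              (trans (sym (split zero)) (cv≡0 zero)))
    c′≡0 : ∀ j → c′ j ≡ false
    c′≡0 = iw c′ λ r → trans (combination-eliminate c′ v p r)
      (trans (cong (λ t → (t ∧ v p (suc r)) xor combination c′ (v ∘ punchIn p) (suc r)) (sym cp≡α))
      (trans (sym (split (suc r))) (cv≡0 (suc r))))
    cp≡0 : c p ≡ false
    cp≡0 = trans cp≡α (∑-zero λ j → cong (_∧ v (punchIn p j) zero) (c′≡0 j))
    c≡0 : ∀ j → c j ≡ false
    c≡0 j with p ≟ᶠ j
    ... | yes refl = cp≡0
    ... | no p≢j   = trans (cong c (sym (punchIn-punchOut p≢j))) (c′≡0 (punchOut p≢j))

independent-tail : ∀ {m d} (v : Fin m → Fin (suc d) → Bool) → (∀ j → v j zero ≡ false) →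
  Independent v → Independent (λ j r → v j (suc r))
independent-tail v v0≡0 iv c cv≡0 = iv c λ
  { zero    → ∑-zero λ j → trans (cong (c j ∧_) (v0≡0 j)) (∧-zeroʳ (c j))
  ; (suc r) → cv≡0 r }

data Pivot {m d} (v : Fin m → Fin (suc d) → Bool) : Set where
  pivotAt : ∀ p → v p zero ≡ true → Pivot v
  noPivot : (∀ j → v j zero ≡ false) → Pivot v

pivot? : ∀ {m d} (v : Fin m → Fin (suc d) → Bool) → Pivot v
pivot? v with any? (λ j → v j zero ≟ᵇ true)
... | yes (p , vp≡1) = pivotAt p vp≡1
... | no ∄p          = noPivot λ j → ¬-not λ vj≡1 → ∄p (j , vj≡1)

independent⇒≤ : ∀ {m d} (v : Fin m → Fin d → Bool) → Independent v → m ≤ d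
independent⇒≤ {zero}          v iv = z≤n
independent⇒≤ {suc m} {zero}  v iv with () ← iv (λ _ → true) (λ ()) zero
independent⇒≤ {suc m} {suc d} v iv with pivot? v
... | pivotAt p vp≡1 = s≤s (independent⇒≤ (eliminate v p) (eliminate-independent v p vp≡1 iv))
... | noPivot v0≡0   = m≤n⇒m≤1+n (independent⇒≤ (λ j r → v j (suc r)) (independent-tail v v0≡0 iv))

-- Counting solutions of a square system modulo 2

parity : ∀ {d} → (Vec Bool d → Bool) → Bool
parity {zero}  g = g []
parity {suc d} g = parity (g ∘ (false ∷_)) xor parity (g ∘ (true ∷_))

parity-cong : ∀ {d} {f g : Vec Bool d → Bool} → (∀ S → f S ≡ g S) → parity f ≡ parity g
parity-cong {zero}  f≗g = f≗g []
parity-cong {suc d} f≗g = cong₂ _xor_ (parity-cong (f≗g ∘ (false ∷_))) (parity-cong (f≗g ∘ (true ∷_)))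

parity-xor : ∀ {d} (f g : Vec Bool d → Bool) → parity (λ S → f S xor g S) ≡ parity f xor parity g
parity-xor {zero}  f g = refl
parity-xor {suc d} f g = begin
  parity (λ S → f (false ∷ S) xor g (false ∷ S)) xor parity (λ S → f (true ∷ S) xor g (true ∷ S))
    ≡⟨ cong₂ _xor_ (parity-xor (f ∘ (false ∷_)) (g ∘ (false ∷_)))
                   (parity-xor (f ∘ (true ∷_)) (g ∘ (true ∷_))) ⟩
  (f₀ xor g₀) xor (f₁ xor g₁)  ≡⟨ interchange f₀ g₀ f₁ g₁ ⟩
  (f₀ xor f₁) xor (g₀ xor g₁)  ∎
  where
  open ≡-Reasoning
  f₀ = parity (f ∘ (false ∷_))
  f₁ = parity (f ∘ (true ∷_))
  g₀ = parity (g ∘ (false ∷_))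
  g₁ = parity (g ∘ (true ∷_))
  interchange : ∀ a b c d → (a ⊕ b) ⊕ (c ⊕ d) ≡ (a ⊕ c) ⊕ (b ⊕ d)
  interchange = solve-∀ F₂-solver

infix 8 _·_
infix 4 _≐_

_·_ : ∀ {d} → Vec Bool d → (Fin d → Bool) → Bool
_·_ {d} S x = ∑[ r < d ] (lookup S r ∧ x r)

·-rankOne : ∀ {d} (S : Vec Bool d) x a y → S · (λ r → x r xor (a ∧ y r)) ≡ S · x xor (a ∧ S · y)
·-rankOne {d} S x a y = trans (∑-∧-xor (lookup S) x (λ r → a ∧ y r)) (cong (S · x xor_)
  (trans (sum-cong-≗ λ r → swap (lookup S r) a (y r)) (sym (*-distribˡ-sum a (λ r → lookup S r ∧ y r)))))
  where
  swap : ∀ x y z → x ⊛ (y ⊛ z) ≡ y ⊛ (x ⊛ z)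
  swap = solve-∀ F₂-solver

_≐_ : Bool → Bool → Bool
x ≐ y = not (x xor y)

solves : ∀ {m d} → (Fin m → Fin d → Bool) → (Fin m → Bool) → Vec Bool d → Bool
solves v b S = ⋀ (λ j → S · v j ≐ b j)

eliminateRhs : ∀ {m d} → (Fin (suc m) → Fin (suc d) → Bool) → (Fin (suc m) → Bool) →
  Fin (suc m) → Fin m → Bool
eliminateRhs v b p j = b (punchIn p j) xor (v (punchIn p j) zero ∧ b p)

-- Summing over the first unknown s: exactly one value of s satisfies the pivot equation.
solves-eliminate : ∀ {m d} (v : Fin (suc m) → Fin (suc d) → Bool) b p → v p zero ≡ true → ∀ S →
  solves v b (false ∷ S) xor solves v b (true ∷ S) ≡ solves (eliminate v p) (eliminateRhs v b p) S
solves-eliminate v b p pivot S = begin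
  solves v b (false ∷ S) xor solves v b (true ∷ S)
    ≡⟨ cong₂ _xor_ (split false) (split true) ⟩
  ((false xor X p ≐ b p) ∧ R false) xor ((true xor X p ≐ b p) ∧ R true)
    ≡⟨ select (X p) (b p) R ⟩
  R (b p xor X p)
    ≡⟨ ⋀-cong (λ j → trans (rearrange (b p) (X p) (v (punchIn p j) zero) (X (punchIn p j)) (b (punchIn p j)))
                  (cong (_≐ eliminateRhs v b p j) (sym (·-rankOne S _ _ _)))) ⟩
  solves (eliminate v p) (eliminateRhs v b p) S  ∎
  where
  open ≡-Reasoning
  X : Fin _ → Bool
  X j = S · (λ r → v j (suc r))
  R : Bool → Bool
  R s = ⋀ (λ j → (s ∧ v (punchIn p j) zero) xor X (punchIn p j) ≐ b (punchIn p j))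
  split : ∀ s → solves v b (s ∷ S) ≡ (s xor X p ≐ b p) ∧ R s
  split s = trans (⋀-remove {i = p} (λ j → (s ∷ S) · v j ≐ b j))
    (cong (λ t → (t xor X p ≐ b p) ∧ R s) (trans (cong (s ∧_) pivot) (∧-identityʳ s)))
  select : ∀ x y (f : Bool → Bool) →
    ((false xor x ≐ y) ∧ f false) xor ((true xor x ≐ y) ∧ f true) ≡ f (y xor x)
  select false false f = xor-identityʳ (f false)
  select false true  f = refl
  select true  false f = refl
  select true  true  f = xor-identityʳ (f false)
  rearrange : ∀ B Xp a Y c → 1# ⊕ ((((B ⊕ Xp) ⊛ a) ⊕ Y) ⊕ c) ≡ 1# ⊕ ((Y ⊕ a ⊛ Xp) ⊕ (c ⊕ a ⊛ B))
  rearrange = solve-∀ F₂-solver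

solves-noPivot : ∀ {m d} (v : Fin m → Fin (suc d) → Bool) b → (∀ j → v j zero ≡ false) → ∀ s S →
  solves v b (s ∷ S) ≡ solves (λ j r → v j (suc r)) b S
solves-noPivot v b v0≡0 s S = ⋀-cong λ j →
  cong (λ t → t xor S · (λ r → v j (suc r)) ≐ b j) (trans (cong (s ∧_) (v0≡0 j)) (∧-zeroʳ s))

parity-solves : ∀ {k} (v : Fin k → Fin k → Bool) b → parity (solves v b) ≡ true ⇔ Independent v
parity-solves {zero}  v b = mk⇔ (λ _ c _ ()) (λ _ → refl)
parity-solves {suc m} v b with pivot? v
... | pivotAt p vp≡1 = mk⇔
  (λ odd → eliminate-independent⁻ v p vp≡1 (Equivalence.to IH (trans (sym reduce) odd)))
  (λ iv → trans reduce (Equivalence.from IH (eliminate-independent v p vp≡1 iv)))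
  where
  IH = parity-solves (eliminate v p) (eliminateRhs v b p)
  reduce : parity (solves v b) ≡ parity (solves (eliminate v p) (eliminateRhs v b p))
  reduce = trans (sym (parity-xor (solves v b ∘ (false ∷_)) (solves v b ∘ (true ∷_))))
                 (parity-cong (solves-eliminate v b p vp≡1))
... | noPivot v0≡0 = mk⇔
  (λ odd → contradiction (trans (sym even) odd) λ ())
  (λ iv → contradiction (independent⇒≤ (λ j r → v j (suc r)) (independent-tail v v0≡0 iv)) 1+n≰n)
  where
  even : parity (solves v b) ≡ false
  even = trans (cong₂ _xor_ (parity-cong (solves-noPivot v b v0≡0 false))
                            (parity-cong (solves-noPivot v b v0≡0 true)))
               (xor-same (parity (solves (λ j r → v j (suc r)) b)))

-- Sums of natural numbers over the enumerations used by M_A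

sum-map-++ : ∀ {X : Set} (f : X → ℕ) xs ys → sum (map f (xs ++ ys)) ≡ sum (map f xs) + sum (map f ys)
sum-map-++ f xs ys = trans (cong sum (map-++ f xs ys)) (sum-++ (map f xs) (map f ys))

sum-map-cong : ∀ {X : Set} {f g : X → ℕ} → (∀ x → f x ≡ g x) → ∀ xs →
  sum (map f xs) ≡ sum (map g xs)
sum-map-cong f≗g xs = cong sum (map-cong f≗g xs)

sum-map-∘ : ∀ {X Y : Set} (f : Y → ℕ) (g : X → Y) xs → sum (map f (map g xs)) ≡ sum (map (f ∘ g) xs)
sum-map-∘ f g xs = cong sum (sym (map-∘ xs))

sum-map-zero : ∀ {X : Set} {f : X → ℕ} → (∀ x → f x ≡ 0) → ∀ xs → sum (map f xs) ≡ 0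
sum-map-zero f≡0 []       = refl
sum-map-zero f≡0 (x ∷ xs) = cong₂ _+_ (f≡0 x) (sum-map-zero f≡0 xs)

sum-map-concatMap : ∀ {X Y : Set} (f : Y → ℕ) (g : X → List Y) xs →
  sum (map f (concatMap g xs)) ≡ sum (map (λ x → sum (map f (g x))) xs)
sum-map-concatMap f g []       = refl
sum-map-concatMap f g (x ∷ xs) =
  trans (sum-map-++ f (g x) (concatMap g xs)) (cong (sum (map f (g x)) +_) (sum-map-concatMap f g xs))

sum-map-allFin-single : ∀ {n} (h : Fin n → ℕ) i → (∀ j → j ≢ i → h j ≡ 0) →
  sum (map h (allFin n)) ≡ h i
sum-map-allFin-single h i h≡0 = trans (cong sum (map-tabulate (λ j → j) h)) (sum-tabulate-single h i h≡0)
  where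
  sum-tabulate-single : ∀ {n} (h : Fin n → ℕ) i → (∀ j → j ≢ i → h j ≡ 0) → sum (tabulate h) ≡ h i
  sum-tabulate-single h zero    h≡0 = trans (cong (h zero +_)
    (trans (cong sum (sym (map-tabulate (λ j → j) (h ∘ suc)))) (sum-map-zero (λ j → h≡0 (suc j) λ ()) (allFin _))))
    (+-identityʳ (h zero))
  sum-tabulate-single h (suc i) h≡0 = trans (cong (_+ sum (tabulate (h ∘ suc))) (h≡0 zero λ ()))
    (sum-tabulate-single (h ∘ suc) i λ j j≢i → h≡0 (suc j) (j≢i ∘ suc-injective))

sum-map-allSubsets-suc : ∀ {k} (h : Subset (suc k) → ℕ) → sum (map h (allSubsets (suc k))) ≡
  sum (map (h ∘ (true ∷_)) (allSubsets k)) + sum (map (h ∘ (false ∷_)) (allSubsets k))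
sum-map-allSubsets-suc {k} h = trans (sum-map-++ h (map (true ∷_) (allSubsets k)) (map (false ∷_) (allSubsets k)))
  (cong₂ _+_ (sum-map-∘ h (true ∷_) (allSubsets k)) (sum-map-∘ h (false ∷_) (allSubsets k)))

sum-map-allSubsets-single : ∀ {k} (h : Subset k → ℕ) S → (∀ S′ → S′ ≢ S → h S′ ≡ 0) →
  sum (map h (allSubsets k)) ≡ h S
sum-map-allSubsets-single h []          _   = +-identityʳ (h [])
sum-map-allSubsets-single h (true ∷ S)  h≡0 = trans (sum-map-allSubsets-suc h) (trans (cong₂ _+_
  (sum-map-allSubsets-single (h ∘ (true ∷_)) S λ S′ S′≢S → h≡0 _ (S′≢S ∘ ∷-injectiveʳ))
  (sum-map-zero (λ S′ → h≡0 (false ∷ S′) λ ()) (allSubsets _))) (+-identityʳ _))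
sum-map-allSubsets-single h (false ∷ S) h≡0 = trans (sum-map-allSubsets-suc h) (cong₂ _+_
  (sum-map-zero (λ S′ → h≡0 (true ∷ S′) λ ()) (allSubsets _))
  (sum-map-allSubsets-single (h ∘ (false ∷_)) S λ S′ S′≢S → h≡0 _ (S′≢S ∘ ∷-injectiveʳ)))

consFalse : ∀ {k} → NESubset k → NESubset (suc k)
consFalse (S , nonempty) = false ∷ S , nonempty

sum-map-nonemptySubsets-suc : ∀ {k} (h : NESubset (suc k) → ℕ) → sum (map h (nonemptySubsets (suc k))) ≡
  sum (map (λ S → h (true ∷ S , _)) (allSubsets k)) + sum (map (h ∘ consFalse) (nonemptySubsets k))
sum-map-nonemptySubsets-suc {k} h =
  trans (sum-map-++ h (map (λ S → true ∷ S , _) (allSubsets k)) (map _ (nonemptySubsets k)))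
  (cong₂ _+_ (sum-map-∘ h _ (allSubsets k))
             (trans (sum-map-∘ h _ (nonemptySubsets k)) (sum-map-cong (λ _ → refl) (nonemptySubsets k))))

sum-map-nonemptySubsets-single : ∀ {k} (h : NESubset k → ℕ) S → (∀ S′ → S′ ≢ S → h S′ ≡ 0) →
  sum (map h (nonemptySubsets k)) ≡ h S
sum-map-nonemptySubsets-single h (true ∷ S , _)  h≡0 = trans (sum-map-nonemptySubsets-suc h) (trans (cong₂ _+_
  (sum-map-allSubsets-single (λ S′ → h (true ∷ S′ , _)) S λ S′ S′≢S →
     h≡0 _ (S′≢S ∘ ∷-injectiveʳ ∘ cong proj₁))
  (sum-map-zero (λ S′ → h≡0 (consFalse S′) λ ()) (nonemptySubsets _))) (+-identityʳ _))
sum-map-nonemptySubsets-single h (false ∷ S , nonempty) h≡0 = trans (sum-map-nonemptySubsets-suc h) (cong₂ _+_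
  (sum-map-zero (λ S′ → h≡0 (true ∷ S′ , _) λ ()) (allSubsets _))
  (sum-map-nonemptySubsets-single (h ∘ consFalse) (S , nonempty) λ S′ S′≢S →
     h≡0 _ (S′≢S ∘ consFalse-injective S′)))
  where
  consFalse-injective : ∀ S′ → consFalse S′ ≡ (false ∷ S , nonempty) → S′ ≡ (S , nonempty)
  consFalse-injective _ refl = refl

sum-map-nonemptySubsets : ∀ k (h : Subset k → ℕ) →
  sum (map (h ∘ proj₁) (nonemptySubsets k)) + h (replicate k false) ≡ sum (map h (allSubsets k))
sum-map-nonemptySubsets zero    h = +-comm 0 (h [])
sum-map-nonemptySubsets (suc k) h = begin
  sum (map (h ∘ proj₁) (nonemptySubsets (suc k))) + h (replicate (suc k) false)
    ≡⟨ cong (_+ h (replicate (suc k) false)) (sum-map-nonemptySubsets-suc (h ∘ proj₁)) ⟩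
  (ones + sum (map (h₀ ∘ proj₁) (nonemptySubsets k))) + h₀ (replicate k false)
    ≡⟨ +-assoc ones _ _ ⟩
  ones + (sum (map (h₀ ∘ proj₁) (nonemptySubsets k)) + h₀ (replicate k false))
    ≡⟨ cong (ones +_) (sum-map-nonemptySubsets k h₀) ⟩
  ones + sum (map h₀ (allSubsets k))
    ≡⟨ sym (sum-map-allSubsets-suc h) ⟩
  sum (map h (allSubsets (suc k)))  ∎
  where
  open ≡-Reasoning
  h₀ = h ∘ (false ∷_)
  ones = sum (map (h ∘ (true ∷_)) (allSubsets k))

fromBool : Bool → ℕ
fromBool b = if b then 1 else 0

sum-map-allSubsets-%2 : ∀ {d} (g : Subset d → Bool) →
  sum (map (fromBool ∘ g) (allSubsets d)) % 2 ≡ fromBool (parity g)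
sum-map-allSubsets-%2 {zero}  g with g []
... | false = refl
... | true  = refl
sum-map-allSubsets-%2 {suc d} g = begin
  sum (map (fromBool ∘ g) (allSubsets (suc d))) % 2
    ≡⟨ cong (_% 2) (sum-map-allSubsets-suc (fromBool ∘ g)) ⟩
  (sum (map (fromBool ∘ g₁) (allSubsets d)) + sum (map (fromBool ∘ g₀) (allSubsets d))) % 2
    ≡⟨ %-distribˡ-+ (sum (map (fromBool ∘ g₁) (allSubsets d))) _ 2 ⟩
  (sum (map (fromBool ∘ g₁) (allSubsets d)) % 2 + sum (map (fromBool ∘ g₀) (allSubsets d)) % 2) % 2
    ≡⟨ cong₂ (λ x y → (x + y) % 2) (sum-map-allSubsets-%2 g₁) (sum-map-allSubsets-%2 g₀) ⟩
  (fromBool (parity g₁) + fromBool (parity g₀)) % 2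
    ≡⟨ fromBool-xor (parity g₁) (parity g₀) ⟩
  fromBool (parity g₁ xor parity g₀)
    ≡⟨ cong fromBool (xor-comm (parity g₁) (parity g₀)) ⟩
  fromBool (parity g)  ∎
  where
  open ≡-Reasoning
  g₀ = g ∘ (false ∷_)
  g₁ = g ∘ (true ∷_)
  fromBool-xor : ∀ x y → (fromBool x + fromBool y) % 2 ≡ fromBool (x xor y)
  fromBool-xor false false = refl
  fromBool-xor false true  = refl
  fromBool-xor true  false = refl
  fromBool-xor true  true  = refl

-- Accepting paths of M_A

inPower : ∀ {X : Set} → (X → Bool) → ℕ → List X → Bool
inPower T zero    []      = true
inPower T zero    (_ ∷ _) = false
inPower T (suc u) []      = false
inPower T (suc u) (a ∷ w) = T a ∧ inPower T u w

inPower-length : ∀ {X : Set} (T : X → Bool) u w → inPower T u w ≡ true → length w ≡ u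
inPower-length T zero    []      _  = refl
inPower-length T (suc u) (a ∷ w) Tw with T a
... | true = cong suc (inPower-length T u w Tw)

inPower-lookup : ∀ {X : Set} (T : X → Bool) w → inPower T (length w) w ≡ ⋀ (T ∘ List.lookup w)
inPower-lookup T []      = refl
inPower-lookup T (a ∷ w) = cong (T a ∧_) (inPower-lookup T w)

toℕ-lowerLast : ∀ {m} (j : Fin (suc m)) → maybe toℕ m (lowerLast j) ≡ toℕ j
toℕ-lowerLast {zero}  zero    = refl
toℕ-lowerLast {suc m} zero    = refl
toℕ-lowerLast {suc m} (suc i) with lowerLast i | toℕ-lowerLast i
... | nothing | m≡i  = cong suc m≡i
... | just i′ | i′≡i = cong suc i′≡i

m∸n≡1+m∸1+n : ∀ {m n} → n < m → m ∸ n ≡ suc (m ∸ suc n)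
m∸n≡1+m∸1+n {suc m} {zero}  _         = refl
m∸n≡1+m∸1+n {suc m} {suc n} (s≤s n<m) = m∸n≡1+m∸1+n n<m

module Paths {m n} (A : Matrix (suc m) n) where

  T : NESubset (suc m) → Fin n → Bool
  T S = inT A (proj₁ S)

  -- Number of paths from q labelled a ∷ w whose first edge is the j-th edge of the S-chain.
  weight : MState (suc m) → Fin n → List (Fin n) → NESubset (suc m) → Fin (suc m) → ℕ
  weight q a w S j = if T S a ∧ ⌊ MState-≟ (srcState S j) q ⌋ then pathsFrom (M A) (tgtState S j) w else 0

  pathsFrom-∷ : ∀ q a w → pathsFrom (M A) q (a ∷ w) ≡
    sum (map (λ S → sum (map (weight q a w S) (allFin (suc m)))) (nonemptySubsets (suc m)))
  pathsFrom-∷ q a w =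
    trans (sum-map-cong (λ _ → refl) (MTransitions A))
    (trans (sum-map-concatMap step (λ S → concatMap (λ j → concatMap (edgesOf S j) (allFin n)) (allFin (suc m)))
                              (nonemptySubsets (suc m)))
    (sum-map-cong (λ S → trans (sum-map-concatMap step (λ j → concatMap (edgesOf S j) (allFin n)) (allFin (suc m)))
      (sum-map-cong (λ j → trans (sum-map-concatMap step (edgesOf S j) (allFin n)) (edges S j)) (allFin (suc m))))
      (nonemptySubsets (suc m))))
    where
    step : MState (suc m) × Fin n × MState (suc m) → ℕ
    step (p , b , r) = if ⌊ MState-≟ p q ⌋ ∧ ⌊ b ≟ᶠ a ⌋ then pathsFrom (M A) r w else 0
    edgesOf : NESubset (suc m) → Fin (suc m) → Fin n → List (MState (suc m) × Fin n × MState (suc m))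
    edgesOf S j i = if T S i then [ (srcState S j , i , tgtState S j) ] else []
    edge : ∀ S j i → sum (map step (edgesOf S j i)) ≡
                     (if T S i then step (srcState S j , i , tgtState S j) else 0)
    edge S j i with T S i
    ... | true  = +-identityʳ _
    ... | false = refl
    edges : ∀ S j → sum (map (λ i → sum (map step (edgesOf S j i))) (allFin n)) ≡ weight q a w S j
    edges S j = trans (sum-map-cong (edge S j) (allFin n)) (trans (sum-map-allFin-single _ a other) this)
      where
      other : ∀ i → i ≢ a → (if T S i then step (srcState S j , i , tgtState S j) else 0) ≡ 0
      other i i≢a with i ≟ᶠ a
      ... | yes i≡a = contradiction i≡a i≢a
      ... | no _ rewrite ∧-zeroʳ ⌊ MState-≟ (srcState S j) q ⌋ = if-eta (T S i)
      this : (if T S a then step (srcState S j , a , tgtState S j) else 0) ≡ weight q a w S j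
      this with a ≟ᶠ a
      ... | no a≢a = contradiction refl a≢a
      ... | yes _ rewrite ∧-identityʳ ⌊ MState-≟ (srcState S j) q ⌋ = sym (if-∧ (T S a))

  weight-≢ : ∀ q a w S j → srcState S j ≢ q → weight q a w S j ≡ 0
  weight-≢ q a w S j src≢q with MState-≟ (srcState S j) q
  ... | yes src≡q = contradiction src≡q src≢q
  ... | no _ rewrite ∧-zeroʳ (T S a) = refl

  weight-src : ∀ a w S j u → pathsFrom (M A) (tgtState S j) w ≡ fromBool (inPower (T S) u w) →
    weight (srcState S j) a w S j ≡ fromBool (inPower (T S) (suc u) (a ∷ w))
  weight-src a w S j u paths≡ with MState-≟ (srcState S j) (srcState S j)
  ... | no src≢src = contradiction refl src≢src
  ... | yes _ rewrite ∧-identityʳ (T S a) with T S a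
  ...   | true  = paths≡
  ...   | false = refl

  pathsFrom-qacc : ∀ {T′ : Fin n → Bool} w → pathsFrom (M A) qacc w ≡ fromBool (inPower T′ 0 w)
  pathsFrom-qacc []      = refl
  pathsFrom-qacc (a ∷ w) = trans (pathsFrom-∷ qacc a w)
    (sum-map-zero (λ S → sum-map-zero (λ j → weight-≢ qacc a w S j (src≢qacc S j)) (allFin (suc m)))
                  (nonemptySubsets (suc m)))
    where
    src≢qacc : ∀ S j → srcState S j ≢ qacc
    src≢qacc S zero    ()
    src≢qacc S (suc j) ()

  -- qmid S j is the paper's q^S_{j+1}, which lies m ∸ j edges before q_k.
  pathsFrom-tgtState : ∀ S j w → pathsFrom (M A) (tgtState S j) w ≡ fromBool (inPower (T S) (m ∸ toℕ j) w)
  pathsFrom-qmid     : ∀ S j w → pathsFrom (M A) (qmid S j) w ≡ fromBool (inPower (T S) (m ∸ toℕ j) w)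

  pathsFrom-tgtState S j w with lowerLast j | toℕ-lowerLast j
  ... | nothing | m≡j  rewrite sym m≡j | n∸n≡0 m = pathsFrom-qacc w
  ... | just j′ | j′≡j =
    trans (pathsFrom-qmid S j′ w) (cong (λ u → fromBool (inPower (T S) (m ∸ u) w)) j′≡j)

  pathsFrom-qmid S j [] rewrite m∸n≡1+m∸1+n (toℕ<n j) = refl
  pathsFrom-qmid S j (a ∷ w) =
    trans (pathsFrom-∷ (qmid S j) a w)
    (trans (sum-map-nonemptySubsets-single _ S λ S′ S′≢S →
             sum-map-zero (λ j′ → weight-≢ (qmid S j) a w S′ j′ (other-chain S′≢S j′)) (allFin (suc m)))
    (trans (sum-map-allFin-single _ (suc j) λ j′ j′≢ → weight-≢ (qmid S j) a w S j′ (other-edge j′≢))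
    (trans (weight-src a w S (suc j) (m ∸ suc (toℕ j)) (pathsFrom-tgtState S (suc j) w))
    (cong (λ u → fromBool (inPower (T S) u (a ∷ w))) (sym (m∸n≡1+m∸1+n (toℕ<n j)))))))
    where
    other-chain : ∀ {S′} → S′ ≢ S → ∀ j′ → srcState S′ j′ ≢ qmid S j
    other-chain S′≢S zero    ()
    other-chain S′≢S (suc j′) refl = S′≢S refl
    other-edge : ∀ {j′} → j′ ≢ suc j → srcState S j′ ≢ qmid S j
    other-edge {zero}   _     ()
    other-edge {suc j′} j′≢ refl = j′≢ refl

  pathsFrom-q₀ : ∀ w → pathsFrom (M A) q₀ w ≡
    sum (map (λ S → fromBool (inPower (T S) (suc m) w)) (nonemptySubsets (suc m)))
  pathsFrom-q₀ []      = sym (sum-map-zero (λ _ → refl) (nonemptySubsets (suc m)))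
  pathsFrom-q₀ (a ∷ w) = trans (pathsFrom-∷ q₀ a w) (sum-map-cong (λ S →
    trans (sum-map-allFin-single _ zero λ j j≢0 → weight-≢ q₀ a w S j (src≢q₀ j≢0))
          (weight-src a w S zero m (pathsFrom-tgtState S zero w)))
    (nonemptySubsets (suc m)))
    where
    src≢q₀ : ∀ {S j} → j ≢ zero → srcState S j ≢ q₀
    src≢q₀ {j = zero}  j≢0 _ = j≢0 refl
    src≢q₀ {j = suc j} _   ()

  pathsFrom-q₀-allSubsets : ∀ w → pathsFrom (M A) q₀ w ≡
    sum (map (λ S → fromBool (inPower (inT A S) (suc m) w)) (allSubsets (suc m)))
  pathsFrom-q₀-allSubsets w = begin
    pathsFrom (M A) q₀ w               ≡⟨ pathsFrom-q₀ w ⟩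
    ∑ₙₑ                                ≡⟨ +-identityʳ ∑ₙₑ ⟨
    ∑ₙₑ + 0                            ≡⟨ cong (∑ₙₑ +_) (cong fromBool (∅-rejects w)) ⟨
    ∑ₙₑ + h (replicate (suc m) false)  ≡⟨ sum-map-nonemptySubsets (suc m) h ⟩
    sum (map h (allSubsets (suc m)))   ∎
    where
    open ≡-Reasoning
    h : Subset (suc m) → ℕ
    h S = fromBool (inPower (inT A S) (suc m) w)
    ∑ₙₑ = sum (map (h ∘ proj₁) (nonemptySubsets (suc m)))
    ∅-rejects : ∀ w → inPower (inT A (replicate (suc m) false)) (suc m) w ≡ false
    ∅-rejects []      = refl
    ∅-rejects (a ∷ w) = cong (_∧ inPower (inT A (replicate (suc m) false)) m w)
      (trans (⨁≡∑ (λ j → lookup (replicate (suc m) false) j ∧ A j a))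
             (∑-zero λ j → cong (_∧ A j a) (lookup-replicate j false)))

∈⊕⇒length : ∀ {m n} (A : Matrix (suc m) n) w → w ∈⊕ M A → length w ≡ suc m
∈⊕⇒length {m} A w accepted with length w ≟ℕ suc m
... | yes length≡ = length≡
... | no  length≢ = contradiction (trans (cong (_% 2) (sym no-paths)) accepted) λ ()
  where
  open Paths A
  no-paths : pathsFrom (M A) q₀ w ≡ 0
  no-paths = trans (pathsFrom-q₀ w) (sum-map-zero
    (λ S → cong fromBool (¬-not λ inPower≡1 → length≢ (inPower-length (T S) (suc m) w inPower≡1)))
    (nonemptySubsets (suc m)))

∈⊕⇔independent : ∀ {n} a (w : List (Fin n)) (A : Matrix (suc (length w)) n) →
  (a ∷ w) ∈⊕ M A ⇔ LinearlyIndependent (λ j → column A (List.lookup (a ∷ w) j))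
∈⊕⇔independent a w A =
  ⇔-trans (mk⇔ (λ odd → fromBool≡1 (trans (sym count) odd)) (λ even → trans count (cong fromBool even)))
  (⇔-trans (parity-solves v (λ _ → true)) (⇔-sym (linearlyIndependent⇔independent v)))
  where
  open Paths A
  v : Fin (suc (length w)) → Fin (suc (length w)) → Bool
  v j = column A (List.lookup (a ∷ w) j)
  ≐-true : ∀ x → (x ≐ true) ≡ x
  ≐-true false = refl
  ≐-true true  = refl
  fromBool≡1 : ∀ {b} → fromBool b ≡ 1 → b ≡ true
  fromBool≡1 {true} _ = refl
  count : pathsFrom (M A) q₀ (a ∷ w) % 2 ≡ fromBool (parity (solves v (λ _ → true)))
  count = begin
    pathsFrom (M A) q₀ (a ∷ w) % 2
      ≡⟨ cong (_% 2) (pathsFrom-q₀-allSubsets (a ∷ w)) ⟩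
    sum (map (λ S → fromBool (inPower (inT A S) (suc (length w)) (a ∷ w))) (allSubsets (suc (length w)))) % 2
      ≡⟨ sum-map-allSubsets-%2 (λ S → inPower (inT A S) (suc (length w)) (a ∷ w)) ⟩
    fromBool (parity (λ S → inPower (inT A S) (suc (length w)) (a ∷ w)))
      ≡⟨ cong fromBool (parity-cong λ S → trans (inPower-lookup (inT A S) (a ∷ w))
           (⋀-cong λ j → trans (⨁≡∑ (λ r → lookup S r ∧ v j r)) (sym (≐-true (S · v j))))) ⟩
    fromBool (parity (solves v (λ _ → true)))  ∎
    where open ≡-Reasoning

-- Words with distinct letters

independent⇒injective : ∀ {m d} (v : Fin m → Fin d → Bool) → Independent v →
  ∀ {i j} → (∀ r → v i r ≡ v j r) → i ≡ j
independent⇒injective {zero}  v iv {()}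
independent⇒injective {suc m} v iv {i} {j} vi≡vj with i ≟ᶠ j
... | yes i≡j = i≡j
... | no  i≢j = contradiction (trans (sym ci≡1) (iv c cv≡0 i)) λ ()
  where
  δ : Fin (suc m) → Fin (suc m) → Bool
  δ p x = ⌊ x ≟ᶠ p ⌋
  c : Fin (suc m) → Bool
  c x = δ i x xor δ j x
  combination-δ : ∀ p r → combination (δ p) v r ≡ v p r
  combination-δ p r = trans (combination-punchIn (δ p) v p r)
    (trans (cong₂ _xor_ hit (∑-zero miss)) (xor-identityʳ (v p r)))
    where
    hit : δ p p ∧ v p r ≡ v p r
    hit with p ≟ᶠ p
    ... | yes _   = refl
    ... | no  p≢p = contradiction refl p≢p
    miss : ∀ x → δ p (punchIn p x) ∧ v (punchIn p x) r ≡ false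
    miss x with punchIn p x ≟ᶠ p
    ... | yes eq = contradiction eq (punchInᵢ≢i p x)
    ... | no  _  = refl
  cv≡0 : ∀ r → combination c v r ≡ false
  cv≡0 r = trans (sum-cong-≗ λ x → ∧-distribʳ-xor (v x r) (δ i x) (δ j x))
    (trans (∑-distrib-+ (λ x → δ i x ∧ v x r) (λ x → δ j x ∧ v x r))
    (trans (cong₂ _xor_ (trans (combination-δ i r) (vi≡vj r)) (combination-δ j r)) (xor-same (v j r))))
  ci≡1 : c i ≡ true
  ci≡1 with i ≟ᶠ i | i ≟ᶠ j
  ... | yes _   | no _    = refl
  ... | no  i≢i | _       = contradiction refl i≢i
  ... | yes _   | yes i≡j = contradiction i≡j i≢j

unique⇒lookup-injective : ∀ {X : Set} {w : List X} → Unique w → Injective _≡_ _≡_ (List.lookup w)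
unique⇒lookup-injective (_  ∷ _)  {zero}  {zero}  _  = refl
unique⇒lookup-injective (x∉ ∷ _)  {zero}  {suc j} eq = contradiction eq (All.lookup x∉ (∈-lookup j))
unique⇒lookup-injective (x∉ ∷ _)  {suc i} {zero}  eq = contradiction (sym eq) (All.lookup x∉ (∈-lookup i))
unique⇒lookup-injective (_  ∷ u)  {suc i} {suc j} eq = cong suc (unique⇒lookup-injective u eq)

lookup-injective⇒unique : ∀ {X : Set} (w : List X) → Injective _≡_ _≡_ (List.lookup w) → Unique w
lookup-injective⇒unique []      _   = []
lookup-injective⇒unique (x ∷ w) inj =
  All.tabulate (λ y∈w x≡y → 0≢1+n (inj (trans x≡y (lookup-index y∈w))))
  ∷ lookup-injective⇒unique w (suc-injective ∘ inj)

∈⊕⇒unique : ∀ {m n} (A : Matrix (suc m) n) w → w ∈⊕ M A → Unique w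
∈⊕⇒unique A w accepted = distinct w (∈⊕⇒length A w accepted) A accepted
  where
  distinct : ∀ {m n} (w : List (Fin n)) → length w ≡ suc m →
    (A : Matrix (suc m) n) → w ∈⊕ M A → Unique w
  distinct (a ∷ w) refl A accepted = lookup-injective⇒unique (a ∷ w) λ lookup≡ →
    independent⇒injective v (Equivalence.to (linearlyIndependent⇔independent v)
      (Equivalence.to (∈⊕⇔independent a w A) accepted)) (λ r → cong (A r) lookup≡)
    where
    v : Fin (suc (length w)) → Fin (suc (length w)) → Bool
    v j = column A (List.lookup (a ∷ w) j)

unique⇒∈⊕ : ∀ {m n} (𝒜 : Matrix (suc m) n → Set) → Covering n (suc m) 𝒜 →
  ∀ w → length w ≡ suc m → Unique w → ∃[ A ] (𝒜 A × w ∈⊕ M A)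
unique⇒∈⊕ 𝒜 covering (a ∷ w) refl u with covering (List.lookup (a ∷ w)) (unique⇒lookup-injective u)
... | A , A∈𝒜 , independent = A , A∈𝒜 , Equivalence.from (∈⊕⇔independent a w A) independent

theorem6p7 : (n k : ℕ) → 1 ≤ k → k ≤ n →
    (𝒜 : Matrix k n → Set) → Covering n k 𝒜 →
    (w : List (Fin n)) →
    (∃[ A ] (𝒜 A × w ∈⊕ M A)) ⇔ Lk k n w
theorem6p7 n (suc m) _ _ 𝒜 covering w = mk⇔
  (λ (A , _ , accepted) → ∈⊕⇒length A w accepted , ∈⊕⇒unique A w accepted)
  (λ (length≡ , unique) → unique⇒∈⊕ 𝒜 covering w length≡ unique)
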